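{- For all compositions $\alpha,\beta$, the product of shuffle basis elements in $\mathrm{QSym}$ is given by the shuffle of compositions: $$S_\alpha\cdot S_\beta=\sum_{\gamma\in\alpha \mathbin{\sqcup\!\sqcup} \beta}S_\gamma,$$ where $\alpha \mathbin{\sqcup\!\sqcup} \beta$ denotes the multiset of shuffles of $\alpha$ and $\beta$.
   Context: A composition $\alpha=(\alpha_1,\dots,\alpha_\ell)$ of $n$ is a finite sequence of positive integers summing to $n$; $\ell(\alpha)=\ell$. For $\alpha,\beta\models n$, $\beta\le\alpha$ means the set of partial sums $\{\beta_1,\beta_1+\beta_2,\dots\}$ is contained in that of $\alpha$ (i.e. $\alpha$ refines $\beta$). For compositions $\alpha$ of length $n$ and $\beta$ of length $m$, with concatenation $\gamma=\alpha\beta=(\gamma_1,\dots,\gamma_{n+m})$, the shuffle $\alpha \mathbin{\sqcup\!\sqcup} \beta$ is the multiset $\{(\gamma_{\sigma(1)},\dots,\gamma_{\sigma(n+m)}):\sigma\in \mathrm{Sh}_{n,m}\}$, where $\mathrm{Sh}_{n,m}=\{\sigma\in\mathfrak S_{n+m}:\sigma^{ -1}(1)<\dots<\sigma^{ -1}(n),\ \sigma^{ -1}(n+1)<\dots<\sigma^{ -1}(n+m)\}$. $M_\alpha=\sum_{i_1<\dots<i_\ell}x_{i_1}^{\alpha_1}\cdots x_{i_\ell}^{\alpha_\ell}$ are the monomial quasisymmetric functions, spanning $\mathrm{QSym}$ (product inherited from power series). For a composition $\alpha$, $\mathrm{OtE}(\alpha)=\{i:\alpha_i\text{ odd},\alpha_{i+1}\text{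 even}\}$; if $\mathrm{OtE}(\alpha)=\{i_1<\dots<i_k\}$, the odd-min composition is $m_o(\alpha)=(\alpha_1+\dots+\alpha_{i_1},\alpha_{i_1+1}+\dots+\alpha_{i_2},\dots,\alpha_{i_k+1}+\dots+\alpha_\ell)$. For $\beta=(\beta_1,\dots,\beta_p)$ with $m_o(\alpha)\le\beta\le\alpha$, each $\beta_i=\alpha_j+\dots+\alpha_{j+k}$; let $\mathrm O_\alpha^\beta(i)$, $\mathrm E_\alpha^\beta(i)$ be the numbers of odd and even parts among $\alpha_j,\dots,\alpha_{j+k}$, set $c_\alpha^\beta(i)=1/(\mathrm O_\alpha^\beta(i)!\,\mathrm E_\alpha^\beta(i)!)$ and $c_\alpha^\beta=\prod_i c_\alpha^\beta(i)$. The shuffle basis is $S_\alpha=\sum_{m_o(\alpha)\le\beta\le\alpha}c_\alpha^\beta M_\beta$. -}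

module Defs where

open import Data.Bool.Base using (Bool; true; false; if_then_else_; _∧_; not)
open import Data.Nat.Base as ℕ using (ℕ; zero; suc; _∸_; _<_; _!; _≡ᵇ_)
open import Data.Nat.Properties using (_!*_!≢0; _≟_)
open import Data.List.Base using (List; []; _∷_; [_]; map; concatMap; upTo; length; _++_; foldr)
open import Data.List.Properties using (≡-dec)
open import Data.List.Relation.Unary.All using (All)
open import Data.Product.Base using (_×_; _,_)
open import Data.Integer.Base using (+_)
open import Data.Rational.Base using (ℚ; 0ℚ; 1ℚ; _+_; _*_; _/_)
open import Relation.Nullary.Decidable using (does)

IsComposition : List ℕ → Set
IsComposition α = All (λ a → 0 < a) α

bfilter : {A : Set} → (A → Bool) → List A → List A
bfilter p []       = []
bfilter p (x ∷ xs) = if p x then x ∷ bfilter p xs else bfilter p xs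

anyᵇ : {A : Set} → (A → Bool) → List A → Bool
anyᵇ p []       = false
anyᵇ p (x ∷ xs) = if p x then true else anyᵇ p xs

allᵇ : {A : Set} → (A → Bool) → List A → Bool
allᵇ p []       = true
allᵇ p (x ∷ xs) = p x ∧ allᵇ p xs

isOdd : ℕ → Bool
isOdd zero    = false
isOdd (suc n) = not (isOdd n)

isEven : ℕ → Bool
isEven n = not (isOdd n)

sumℕ : List ℕ → ℕ
sumℕ = foldr ℕ._+_ 0

partialSumsFrom : ℕ → List ℕ → List ℕ
partialSumsFrom acc []       = []
partialSumsFrom acc (x ∷ xs) = (acc ℕ.+ x) ∷ partialSumsFrom (acc ℕ.+ x) xs

partialSums : List ℕ → List ℕ
partialSums = partialSumsFrom 0

_∈ᵇ_ : ℕ → List ℕ → Bool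
n ∈ᵇ xs = anyᵇ (λ m → n ≡ᵇ m) xs

-- β ≤ α  iff  partial sums of β ⊆ partial sums of α  (α refines β)
_≤ᶜ_ : List ℕ → List ℕ → Bool
β ≤ᶜ α = allᵇ (λ s → s ∈ᵇ partialSums α) (partialSums β)

-- odd-min composition m_o(α): cut α exactly after the positions i with
-- α_i odd and α_{i+1} even (i ∈ OtE(α)), and sum each block
mo : List ℕ → List ℕ
mo []            = []
mo (a ∷ [])      = a ∷ []
mo (a ∷ b ∷ rest) with isOdd a ∧ isEven b | mo (b ∷ rest)
... | true  | r       = a ∷ r
... | false | []      = a ∷ []
... | false | c ∷ cs  = (a ℕ.+ c) ∷ cs

-- all ways of cutting α into consecutive nonempty blocks
-- (in bijection with the compositions β with β ≤ α, via β = map sumℕ blocks)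
blockings : List ℕ → List (List (List ℕ))
blockings []       = [] ∷ []
blockings (a ∷ as) = concatMap step (blockings as)
  where
  step : List (List ℕ) → List (List (List ℕ))
  step []         = ((a ∷ []) ∷ []) ∷ []
  step (b ∷ bs)   = ((a ∷ []) ∷ b ∷ bs) ∷ ((a ∷ b) ∷ bs) ∷ []

sumℚ : List ℚ → ℚ
sumℚ = foldr _+_ 0ℚ

prodℚ : List ℚ → ℚ
prodℚ = foldr _*_ 1ℚ

blockCoeff : List ℕ → ℚ
blockCoeff blk = (+ 1) / (o ! ℕ.* e !)
  where
  o = length (bfilter isOdd blk)
  e = length (bfilter isEven blk)
  instance _ = o !* e !≢0

coeff : List (List ℕ) → ℚ
coeff bs = prodℚ (map blockCoeff bs)

-- Formal power series in x₁, x₂, … with rational coefficients.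
-- A monomial x₁^{e₁} ⋯ x_k^{e_k} is represented by its exponent list
-- (e₁, …, e_k); trailing zeros do not matter for anything below.

Series : Set
Series = List ℕ → ℚ

nonzeros : List ℕ → List ℕ
nonzeros = bfilter (λ n → not (n ≡ᵇ 0))

M : List ℕ → Series
M α e = if does (≡-dec _≟_ (nonzeros e) α) then 1ℚ else 0ℚ

splits : List ℕ → List (List ℕ × List ℕ)
splits []       = ([] , []) ∷ []
splits (n ∷ e)  = concatMap (λ k → map (λ { (d , d') → (k ∷ d , (n ∸ k) ∷ d') }) (splits e)) (upTo (suc n))

_·ₛ_ : Series → Series → Series
(f ·ₛ g) e = sumℚ (map (λ { (d , d') → f d * g d' }) (splits e))

ΣS : List Series → Series
ΣS fs e = sumℚ (map (λ f → f e) fs)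

S : List ℕ → Series
S α = ΣS (map term (blockings α))
  where
  term : List (List ℕ) → Series
  term bs = let β = map sumℕ bs in
    if (mo α ≤ᶜ β) ∧ (β ≤ᶜ α) then (λ e → coeff bs * M β e) else (λ e → 0ℚ)

-- Shuffle of compositions, as a list (multiset with multiplicity):
-- one entry for each σ ∈ Sh_{n,m}

shuffle : List ℕ → List ℕ → List (List ℕ)
shuffle []       β        = β ∷ []
shuffle (a ∷ α)  []       = (a ∷ α) ∷ []
shuffle (a ∷ α)  (b ∷ β)  = map (a ∷_) (shuffle α (b ∷ β)) ++ map (b ∷_) (shuffle (a ∷ α) β)

-- A blocking of α lies in the range m_o(α) ≤ β ≤ α exactly when none of its blocks contains an odd part followed by
-- an even one, so expanding S_α along its first block u gives
--   S_α(x₁^k x′) = Σ_{α = u ++ v, OtE(u) = ∅, Σu = k} c(u) S_v(x′),   c(u) = 1 / (O(u)! E(u)!).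
-- The product formula then follows by induction on the exponent vector from two facts.  Deconcatenation is a
-- morphism for the shuffle product.  For blocks u, u′ without OtE (runs of evens followed by runs of odds), the
-- shuffles of u and u′ without OtE are a shuffle of the evens followed by a shuffle of the odds, so there are
-- C(E+E′, E) C(O+O′, O) of them, each with c = 1 / ((O+O′)! (E+E′)!); hence the weights c are multiplicative:
--   Σ_{r ∈ u ⧢ u′, OtE(r) = ∅} c(r) = c(u) c(u′).

module Submission where

open import Defs
open import Data.Bool.Base using (Bool; true; false; if_then_else_; _∧_; not)
open import Data.Bool.Properties using (∧-assoc; ∧-identityʳ; ∧-zeroʳ; if-float; if-cong)
open import Data.List.Base using (List; []; _∷_; _++_; map; concatMap; upTo; length; _∷ʳ_)
import Data.List.Properties as List
open import Data.List.Relation.Unary.All as All using (All; []; _∷_)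
import Data.List.Relation.Unary.All.Properties as All
open import Data.List.Relation.Binary.Permutation.Propositional
  using (_↭_; prep; swap; ↭-sym; ↭-reflexive) renaming (refl to ↭-refl; trans to ↭-trans)
import Data.List.Relation.Binary.Permutation.Propositional.Properties as ↭
open import Data.Nat.Base as ℕ using (ℕ; zero; suc; _≡ᵇ_; _!)
import Data.Nat.Properties as ℕ
open import Data.Nat.Tactic.RingSolver using (solve-∀)
open import Data.Nat.ListAction.Properties using (sum-↭; sum-++)
open import Data.Product.Base using (_×_; _,_; proj₁; proj₂; map₁; ∃₂)
open import Function.Base using (_∘_)
open import Algebra.Bundles using (CommutativeMonoid)
open import Relation.Binary.Definitions using (Tri; tri<; tri≈; tri>)
open import Relation.Nullary.Negation using (¬_)
open import Relation.Nullary.Decidable using (dec-true; dec-false; does-≡; map′; _×-dec_)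
open import Data.Rational.Base using (ℚ; 0ℚ; 1ℚ; _+_; _*_; _/_)
open import Data.Rational.Properties
  using ( +-0-commutativeMonoid; *-1-commutativeMonoid; +-assoc; +-comm; +-identityˡ; +-identityʳ
        ; *-assoc; *-comm; *-identityˡ; *-zeroˡ; *-zeroʳ; *-distribˡ-+; *-distribʳ-+)
open import Relation.Binary.PropositionalEquality using (_≡_; _≢_; refl; sym; trans; cong; cong₂; subst; module ≡-Reasoning)

Σ[_]_ : {A : Set} → List A → (A → ℚ) → ℚ
Σ[ xs ] f = sumℚ (map f xs)

module _ {A : Set} where

  Σ-cong : (xs : List A) {f g : A → ℚ} → (∀ x → f x ≡ g x) → Σ[ xs ] f ≡ Σ[ xs ] g
  Σ-cong []       f≗g = refl
  Σ-cong (x ∷ xs) f≗g = cong₂ _+_ (f≗g x) (Σ-cong xs f≗g)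

  Σ-cong-All : {xs : List A} {f g : A → ℚ} → All (λ x → f x ≡ g x) xs → Σ[ xs ] f ≡ Σ[ xs ] g
  Σ-cong-All []           = refl
  Σ-cong-All (fx≡gx ∷ hs) = cong₂ _+_ fx≡gx (Σ-cong-All hs)

  Σ-++ : (xs ys : List A) (f : A → ℚ) → Σ[ xs ++ ys ] f ≡ Σ[ xs ] f + Σ[ ys ] f
  Σ-++ []       ys f = sym (+-identityˡ _)
  Σ-++ (x ∷ xs) ys f = trans (cong (f x +_) (Σ-++ xs ys f)) (sym (+-assoc (f x) _ _))

  Σ-zero : (xs : List A) → Σ[ xs ] (λ _ → 0ℚ) ≡ 0ℚ
  Σ-zero []       = refl
  Σ-zero (x ∷ xs) = trans (+-identityˡ _) (Σ-zero xs)

  Σ-+ : (xs : List A) (f g : A → ℚ) → Σ[ xs ] (λ x → f x + g x) ≡ Σ[ xs ] f + Σ[ xs ] g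
  Σ-+ []       f g = sym (+-identityˡ 0ℚ)
  Σ-+ (x ∷ xs) f g = begin
    (f x + g x) + Σ[ xs ] (λ x → f x + g x) ≡⟨ cong ((f x + g x) +_) (Σ-+ xs f g) ⟩
    (f x + g x) + (F + G)                   ≡⟨ +-assoc (f x) (g x) (F + G) ⟩
    f x + (g x + (F + G))                   ≡⟨ cong (f x +_) (sym (+-assoc (g x) F G)) ⟩
    f x + ((g x + F) + G)                   ≡⟨ cong (λ z → f x + (z + G)) (+-comm (g x) F) ⟩
    f x + ((F + g x) + G)                   ≡⟨ cong (f x +_) (+-assoc F (g x) G) ⟩
    f x + (F + (g x + G))                   ≡⟨ sym (+-assoc (f x) F (g x + G)) ⟩
    (f x + F) + (g x + G)                   ∎
    where
    open ≡-Reasoning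
    F G : ℚ
    F = Σ[ xs ] f
    G = Σ[ xs ] g

  Σ-*ˡ : (xs : List A) (c : ℚ) (f : A → ℚ) → Σ[ xs ] (λ x → c * f x) ≡ c * Σ[ xs ] f
  Σ-*ˡ []       c f = sym (*-zeroʳ c)
  Σ-*ˡ (x ∷ xs) c f = trans (cong (c * f x +_) (Σ-*ˡ xs c f)) (sym (*-distribˡ-+ c (f x) _))

  Σ-*ʳ : (xs : List A) (c : ℚ) (f : A → ℚ) → Σ[ xs ] (λ x → f x * c) ≡ Σ[ xs ] f * c
  Σ-*ʳ xs c f = trans (Σ-cong xs (λ x → *-comm (f x) c)) (trans (Σ-*ˡ xs c f) (*-comm c _))

module _ {A B : Set} where

  Σ-map : (xs : List A) (g : A → B) (f : B → ℚ) → Σ[ map g xs ] f ≡ Σ[ xs ] (λ x → f (g x))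
  Σ-map []       g f = refl
  Σ-map (x ∷ xs) g f = cong (f (g x) +_) (Σ-map xs g f)

  Σ-concatMap : (xs : List A) (g : A → List B) (f : B → ℚ) →
    Σ[ concatMap g xs ] f ≡ Σ[ xs ] (λ x → Σ[ g x ] f)
  Σ-concatMap []       g f = refl
  Σ-concatMap (x ∷ xs) g f = trans (Σ-++ (g x) (concatMap g xs) f) (cong (Σ[ g x ] f +_) (Σ-concatMap xs g f))

  Σ-swap : (xs : List A) (ys : List B) (f : A → B → ℚ) →
    Σ[ xs ] (λ x → Σ[ ys ] (f x)) ≡ Σ[ ys ] (λ y → Σ[ xs ] (λ x → f x y))
  Σ-swap []       ys f = sym (Σ-zero ys)
  Σ-swap (x ∷ xs) ys f = trans (cong (Σ[ ys ] (f x) +_) (Σ-swap xs ys f)) (sym (Σ-+ ys (f x) _))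

  Σ-*-Σ : (xs : List A) (ys : List B) (f : A → ℚ) (g : B → ℚ) →
    Σ[ xs ] f * Σ[ ys ] g ≡ Σ[ xs ] (λ x → Σ[ ys ] (λ y → f x * g y))
  Σ-*-Σ xs ys f g = trans (sym (Σ-*ʳ xs (Σ[ ys ] g) f)) (Σ-cong xs (λ x → sym (Σ-*ˡ ys (f x) g)))

module _ {I X Y : Set} where

  Σ-swap₂ : (is : List I) (xs : List X) (ys : List Y) (f : I → X → Y → ℚ) →
    Σ[ is ] (λ i → Σ[ xs ] (λ x → Σ[ ys ] (f i x))) ≡ Σ[ xs ] (λ x → Σ[ ys ] (λ y → Σ[ is ] (λ i → f i x y)))
  Σ-swap₂ is xs ys f = trans (Σ-swap is xs (λ i x → Σ[ ys ] (f i x))) (Σ-cong xs (λ x → Σ-swap is ys (λ i → f i x)))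

  Σ-*-Σ-interchange : (is : List I) (xs : List X) (ys : List Y) (f : I → X → ℚ) (g : I → Y → ℚ) →
    Σ[ is ] (λ i → Σ[ xs ] (f i) * Σ[ ys ] (g i)) ≡ Σ[ xs ] (λ x → Σ[ ys ] (λ y → Σ[ is ] (λ i → f i x * g i y)))
  Σ-*-Σ-interchange is xs ys f g =
    trans (Σ-cong is (λ i → Σ-*-Σ xs ys (f i) (g i))) (Σ-swap₂ is xs ys (λ i x y → f i x * g i y))

when : Bool → ℚ → ℚ
when b x = if b then x else 0ℚ

when-*ˡ : ∀ b x y → when b x * y ≡ when b (x * y)
when-*ˡ true  x y = refl
when-*ˡ false x y = *-zeroˡ y

Σ-when : {A : Set} (xs : List A) (b : Bool) (f : A → ℚ) → Σ[ xs ] (λ x → when b (f x)) ≡ when b (Σ[ xs ] f)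
Σ-when xs true  f = refl
Σ-when xs false f = Σ-zero xs

when-*-when : ∀ b c x y → when b x * when c y ≡ when (b ∧ c) (x * y)
when-*-when true  true  x y = refl
when-*-when true  false x y = *-zeroʳ x
when-*-when false c     x y = *-zeroˡ (when c y)

<ᵇ-true : ∀ {m n} → m ℕ.< n → (m ℕ.<ᵇ n) ≡ true
<ᵇ-true {m} {n} = dec-true (m ℕ.<? n)

<ᵇ-false : ∀ {m n} → ¬ m ℕ.< n → (m ℕ.<ᵇ n) ≡ false
<ᵇ-false {m} {n} = dec-false (m ℕ.<? n)

≡ᵇ-true : ∀ {m n} → m ≡ n → (m ≡ᵇ n) ≡ true
≡ᵇ-true {m} {n} = dec-true (m ℕ.≟ n)

≡ᵇ-false : ∀ {m n} → m ≢ n → (m ≡ᵇ n) ≡ false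
≡ᵇ-false {m} {n} = dec-false (m ℕ.≟ n)

Σ-upTo-≡ᵇ : ∀ m a (φ : ℕ → Bool) c → Σ[ upTo m ] (λ k → when ((k ≡ᵇ a) ∧ φ k) c) ≡ when ((a ℕ.<ᵇ m) ∧ φ a) c
Σ-upTo-≡ᵇ zero    a φ c = refl
Σ-upTo-≡ᵇ (suc m) a φ c = begin
  Σ[ upTo (suc m) ] f                  ≡⟨ cong (Σ[_] f) (sym (List.upTo-∷ʳ m)) ⟩
  Σ[ upTo m ∷ʳ m ] f                   ≡⟨ Σ-++ (upTo m) (m ∷ []) f ⟩
  Σ[ upTo m ] f + (f m + 0ℚ)           ≡⟨ cong₂ _+_ (Σ-upTo-≡ᵇ m a φ c) (+-identityʳ (f m)) ⟩
  when ((a ℕ.<ᵇ m) ∧ φ a) c + f m      ≡⟨ last-term (ℕ.<-cmp a m) ⟩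
  when ((a ℕ.<ᵇ suc m) ∧ φ a) c        ∎
  where
  open ≡-Reasoning
  f : ℕ → ℚ
  f k = when ((k ≡ᵇ a) ∧ φ k) c
  last-term : Tri (a ℕ.< m) (a ≡ m) (a ℕ.> m) → when ((a ℕ.<ᵇ m) ∧ φ a) c + f m ≡ when ((a ℕ.<ᵇ suc m) ∧ φ a) c
  last-term (tri< a<m a≢m _)
    rewrite <ᵇ-true a<m | <ᵇ-true (ℕ.m<n⇒m<1+n a<m) | ≡ᵇ-false (a≢m ∘ sym) = +-identityʳ _
  last-term (tri≈ _ refl _)
    rewrite <ᵇ-false (ℕ.<-irrefl {a} refl) | <ᵇ-true (ℕ.n<1+n a) | ≡ᵇ-true {a} refl = +-identityˡ _
  last-term (tri> _ a≢m m<a)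
    rewrite <ᵇ-false (ℕ.<-asym m<a) | <ᵇ-false (ℕ.<⇒≱ m<a ∘ ℕ.≤-pred) | ≡ᵇ-false (a≢m ∘ sym) = +-identityˡ _

Σ-upTo-convolution : ∀ n a b c →
  Σ[ upTo (suc n) ] (λ k → when ((k ≡ᵇ a) ∧ (n ℕ.∸ k ≡ᵇ b)) c) ≡ when (n ≡ᵇ a ℕ.+ b) c
-- Both booleans decide the same proposition; the truncated n ∸ a is harmless since a ≤ n is part of the left one.
Σ-upTo-convolution n a b c = trans (Σ-upTo-≡ᵇ (suc n) a (λ k → n ℕ.∸ k ≡ᵇ b) c)
  (if-cong (does-≡ (map′ to from (a ℕ.<? suc n ×-dec n ℕ.∸ a ℕ.≟ b)) (n ℕ.≟ a ℕ.+ b)))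
  where
  to : a ℕ.< suc n × n ℕ.∸ a ≡ b → n ≡ a ℕ.+ b
  to (a≤n , refl) = sym (ℕ.m+[n∸m]≡n (ℕ.≤-pred a≤n))
  from : n ≡ a ℕ.+ b → a ℕ.< suc n × n ℕ.∸ a ≡ b
  from refl = ℕ.s≤s (ℕ.m≤m+n a b) , ℕ.m+n∸m≡n a b

-- Shuffles

shuffle-↭ : (p q : List ℕ) → All (_↭ p ++ q) (shuffle p q)
shuffle-↭ []      q       = ↭-refl ∷ []
shuffle-↭ (a ∷ p) []      = ↭-reflexive (sym (List.++-identityʳ (a ∷ p))) ∷ []
shuffle-↭ (a ∷ p) (b ∷ q) = All.++⁺
  (All.map⁺ (All.map (prep a) (shuffle-↭ p (b ∷ q))))
  (All.map⁺ (All.map (λ r↭ → ↭-trans (prep b r↭) (↭-sym (↭.shift b (a ∷ p) q))) (shuffle-↭ (a ∷ p) q)))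

shuffle-composition : ∀ {p q} → IsComposition p → IsComposition q → All IsComposition (shuffle p q)
shuffle-composition {p} {q} cp cq =
  All.map (λ r↭ → ↭.All-resp-↭ (↭-sym r↭) (All.++⁺ cp cq)) (shuffle-↭ p q)

module _ {A : Set} (f : A → Bool) where

  count : List A → ℕ
  count xs = length (bfilter f xs)

  bfilter-++ : (xs ys : List A) → bfilter f (xs ++ ys) ≡ bfilter f xs ++ bfilter f ys
  bfilter-++ []       ys = refl
  bfilter-++ (x ∷ xs) ys with f x
  ... | true  = cong (x ∷_) (bfilter-++ xs ys)
  ... | false = bfilter-++ xs ys

  bfilter-↭ : ∀ {xs ys} → xs ↭ ys → bfilter f xs ↭ bfilter f ys
  bfilter-↭ ↭-refl = ↭-refl
  bfilter-↭ (prep x p) with f x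
  ... | true  = prep x (bfilter-↭ p)
  ... | false = bfilter-↭ p
  bfilter-↭ (swap x y p) with f x | f y
  ... | true  | true  = swap x y (bfilter-↭ p)
  ... | true  | false = prep x (bfilter-↭ p)
  ... | false | true  = prep y (bfilter-↭ p)
  ... | false | false = bfilter-↭ p
  bfilter-↭ (↭-trans p q) = ↭-trans (bfilter-↭ p) (bfilter-↭ q)

  count-++ : (xs ys : List A) → count (xs ++ ys) ≡ count xs ℕ.+ count ys
  count-++ xs ys = trans (cong length (bfilter-++ xs ys)) (List.length-++ (bfilter f xs))

  count-↭ : ∀ {xs ys} → xs ↭ ys → count xs ≡ count ys
  count-↭ xs↭ys = ↭.↭-length (bfilter-↭ xs↭ys)

  allᵇ-++ : (xs ys : List A) → allᵇ f (xs ++ ys) ≡ allᵇ f xs ∧ allᵇ f ys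
  allᵇ-++ []       ys = refl
  allᵇ-++ (x ∷ xs) ys = trans (cong (f x ∧_) (allᵇ-++ xs ys)) (sym (∧-assoc (f x) _ _))

  allᵇ-↭ : ∀ {xs ys} → xs ↭ ys → allᵇ f xs ≡ allᵇ f ys
  allᵇ-↭ ↭-refl       = refl
  allᵇ-↭ (prep x p)   = cong (f x ∧_) (allᵇ-↭ p)
  allᵇ-↭ (swap x y p) with f x | f y
  ... | true  | true  = allᵇ-↭ p
  ... | true  | false = refl
  ... | false | true  = refl
  ... | false | false = refl
  allᵇ-↭ (↭-trans p q) = trans (allᵇ-↭ p) (allᵇ-↭ q)

module _ {A : Set} where

  count-cong : {f g : A → Bool} → (∀ x → f x ≡ g x) → ∀ xs → count f xs ≡ count g xs
  count-cong         f≗g []       = refl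
  count-cong {f} {g} f≗g (x ∷ xs) rewrite f≗g x with g x
  ... | true  = cong suc (count-cong f≗g xs)
  ... | false = count-cong f≗g xs

  count-const : (f : A → Bool) {b : Bool} {xs : List A} → All (λ x → f x ≡ b) xs →
    count f xs ≡ (if b then length xs else 0)
  count-const f {true}  []         = refl
  count-const f {false} []         = refl
  count-const f {b} {x ∷ xs} (fx≡b ∷ hs) rewrite fx≡b with b
  ... | true  = cong suc (count-const f hs)
  ... | false = count-const f hs

count-map : {A B : Set} (f : B → Bool) (g : A → B) (xs : List A) → count f (map g xs) ≡ count (f ∘ g) xs
count-map f g []       = refl
count-map f g (x ∷ xs) with f (g x)
... | true  = cong suc (count-map f g xs)
... | false = count-map f g xs

count-shuffle : (f : ℕ → Bool) (p q : List ℕ) → All (λ r → count f r ≡ count f p ℕ.+ count f q) (shuffle p q)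
count-shuffle f p q = All.map (λ r↭ → trans (count-↭ f r↭) (count-++ f p q)) (shuffle-↭ p q)

allᵇ-shuffle : (f : ℕ → Bool) (p q : List ℕ) → All (λ r → allᵇ f r ≡ allᵇ f p ∧ allᵇ f q) (shuffle p q)
allᵇ-shuffle f p q = All.map (λ r↭ → trans (allᵇ-↭ f r↭) (allᵇ-++ f p q)) (shuffle-↭ p q)

sum-shuffle : (p q : List ℕ) → All (λ r → sumℕ r ≡ sumℕ p ℕ.+ sumℕ q) (shuffle p q)
sum-shuffle p q = All.map (λ r↭ → trans (sum-↭ r↭) (sum-++ p q)) (shuffle-↭ p q)

nShuffles : ℕ → ℕ → ℕ
nShuffles zero    n       = 1
nShuffles (suc m) zero    = 1
nShuffles (suc m) (suc n) = nShuffles m (suc n) ℕ.+ nShuffles (suc m) n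

nShuffles-zeroʳ : ∀ m → nShuffles m 0 ≡ 1
nShuffles-zeroʳ zero    = refl
nShuffles-zeroʳ (suc m) = refl

length-shuffle : (p q : List ℕ) → length (shuffle p q) ≡ nShuffles (length p) (length q)
length-shuffle []      q       = refl
length-shuffle (a ∷ p) []      = refl
length-shuffle (a ∷ p) (b ∷ q) = begin
  length (map (a ∷_) (shuffle p (b ∷ q)) ++ map (b ∷_) (shuffle (a ∷ p) q))
    ≡⟨ List.length-++ (map (a ∷_) (shuffle p (b ∷ q))) ⟩
  length (map (a ∷_) (shuffle p (b ∷ q))) ℕ.+ length (map (b ∷_) (shuffle (a ∷ p) q))
    ≡⟨ cong₂ ℕ._+_ (List.length-map (a ∷_) (shuffle p (b ∷ q))) (List.length-map (b ∷_) (shuffle (a ∷ p) q)) ⟩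
  length (shuffle p (b ∷ q)) ℕ.+ length (shuffle (a ∷ p) q)
    ≡⟨ cong₂ ℕ._+_ (length-shuffle p (b ∷ q)) (length-shuffle (a ∷ p) q) ⟩
  nShuffles (length p) (suc (length q)) ℕ.+ nShuffles (suc (length p)) (length q) ∎
  where open ≡-Reasoning

nShuffles-! : ∀ m n → nShuffles m n ℕ.* m ! ℕ.* n ! ≡ (m ℕ.+ n) !
nShuffles-! zero    n       = ℕ.+-identityʳ (n !)
nShuffles-! (suc m) zero    = trans (ℕ.*-identityʳ _) (trans (ℕ.+-identityʳ _) (cong _! (sym (ℕ.+-identityʳ (suc m)))))
nShuffles-! (suc m) (suc n) = begin
  (L ℕ.+ R) ℕ.* (suc m ℕ.* m !) ℕ.* (suc n ℕ.* n !)
    ≡⟨ expand L R m n (m !) (n !) ⟩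
  (L ℕ.* m ! ℕ.* suc n !) ℕ.* suc m ℕ.+ (R ℕ.* suc m ! ℕ.* n !) ℕ.* suc n
    ≡⟨ cong₂ (λ u v → u ℕ.* suc m ℕ.+ v ℕ.* suc n) (trans (nShuffles-! m (suc n)) (cong _! (ℕ.+-suc m n))) (nShuffles-! (suc m) n) ⟩
  K ℕ.* suc m ℕ.+ K ℕ.* suc n
    ≡⟨ sym (ℕ.*-distribˡ-+ K (suc m) (suc n)) ⟩
  K ℕ.* (suc m ℕ.+ suc n)
    ≡⟨ ℕ.*-comm K _ ⟩
  (suc m ℕ.+ suc n) ℕ.* K
    ≡⟨ cong (λ k → (suc m ℕ.+ suc n) ℕ.* k !) (sym (ℕ.+-suc m n)) ⟩
  (suc m ℕ.+ suc n) ! ∎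
  where
  open ≡-Reasoning
  L R K : ℕ
  L = nShuffles m (suc n)
  R = nShuffles (suc m) n
  K = (suc m ℕ.+ n) !
  expand : ∀ X Y m n fm fn →
    (X ℕ.+ Y) ℕ.* (suc m ℕ.* fm) ℕ.* (suc n ℕ.* fn) ≡
    (X ℕ.* fm ℕ.* (suc n ℕ.* fn)) ℕ.* suc m ℕ.+ (Y ℕ.* (suc m ℕ.* fm) ℕ.* fn) ℕ.* suc n
  expand = solve-∀

-- Blocks without odd-to-even descents

-- noOtE w holds iff OtE(w) = ∅, i.e. w is a run of even parts followed by a run of odd parts.
noOtE : List ℕ → Bool
noOtE []          = true
noOtE (x ∷ [])    = true
noOtE (x ∷ y ∷ w) = not (isOdd x ∧ isEven y) ∧ noOtE (y ∷ w)

allOdd : List ℕ → Bool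
allOdd = allᵇ isOdd

#odd #even : List ℕ → ℕ
#odd  = count isOdd
#even = count isEven

noOtE-odd-∷ : ∀ x w → isOdd x ≡ true → noOtE (x ∷ w) ≡ allOdd w
noOtE-odd-∷ x []      _ = refl
noOtE-odd-∷ x (y ∷ w) x-odd rewrite x-odd with isOdd y in y-odd
... | true  = noOtE-odd-∷ y w y-odd
... | false = refl

noOtE-even-∷ : ∀ x w → isOdd x ≡ false → noOtE (x ∷ w) ≡ noOtE w
noOtE-even-∷ x []      _ = refl
noOtE-even-∷ x (y ∷ w) x-even rewrite x-even = refl

#even-allOdd : ∀ w → allOdd w ≡ true → #even w ≡ 0
#even-allOdd []      _ = refl
#even-allOdd (x ∷ w) h with isOdd x
... | true = #even-allOdd w h

#odd-allOdd : ∀ w → allOdd w ≡ true → #odd w ≡ length w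
#odd-allOdd []      _ = refl
#odd-allOdd (x ∷ w) h with isOdd x
... | true = cong suc (#odd-allOdd w h)

count-allOdd-shuffle : ∀ p q → count allOdd (shuffle p q) ≡ (if allOdd p ∧ allOdd q then nShuffles (length p) (length q) else 0)
count-allOdd-shuffle p q with allOdd p ∧ allOdd q in eq
... | true  = trans (count-const allOdd (All.map (λ h → trans h eq) (allᵇ-shuffle isOdd p q))) (length-shuffle p q)
... | false = count-const allOdd (All.map (λ h → trans h eq) (allᵇ-shuffle isOdd p q))

count-noOtE-∷ : ∀ x rs → count (λ r → noOtE (x ∷ r)) rs ≡ (if isOdd x then count allOdd rs else count noOtE rs)
count-noOtE-∷ x rs with isOdd x in eq
... | true  = count-cong (λ r → noOtE-odd-∷ x r eq) rs
... | false = count-cong (λ r → noOtE-even-∷ x r eq) rs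

module _ (a : ℕ) (p : List ℕ) (b : ℕ) (q : List ℕ) where

  private
    S₁ S₂ : List (List ℕ)
    S₁ = shuffle p (b ∷ q)
    S₂ = shuffle (a ∷ p) q

  count-noOtE-shuffle-∷-∷ : ∀ oa ob → isOdd a ≡ oa → isOdd b ≡ ob →
    count noOtE S₁ ≡ (if noOtE p ∧ noOtE (b ∷ q) then nShuffles (#even p) (#even (b ∷ q)) ℕ.* nShuffles (#odd p) (#odd (b ∷ q)) else 0) →
    count noOtE S₂ ≡ (if noOtE (a ∷ p) ∧ noOtE q then nShuffles (#even (a ∷ p)) (#even q) ℕ.* nShuffles (#odd (a ∷ p)) (#odd q) else 0) →
    (if oa then count allOdd S₁ else count noOtE S₁) ℕ.+ (if ob then count allOdd S₂ else count noOtE S₂) ≡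
    (if noOtE (a ∷ p) ∧ noOtE (b ∷ q)
       then nShuffles (#even (a ∷ p)) (#even (b ∷ q)) ℕ.* nShuffles (#odd (a ∷ p)) (#odd (b ∷ q)) else 0)
  count-noOtE-shuffle-∷-∷ false false ea eb ih₁ ih₂
    rewrite ih₁ | ih₂
          | noOtE-even-∷ a p ea | noOtE-even-∷ b q eb | ea | eb
    with noOtE p ∧ noOtE q
  ... | true  = sym (ℕ.*-distribʳ-+ (nShuffles (#odd p) (#odd q)) (nShuffles (#even p) (suc (#even q))) (nShuffles (suc (#even p)) (#even q)))
  ... | false = refl
  count-noOtE-shuffle-∷-∷ true false ea eb _ ih₂
    rewrite count-allOdd-shuffle p (b ∷ q) | ih₂
          | noOtE-odd-∷ a p ea | noOtE-even-∷ b q eb | ea | eb | ∧-zeroʳ (allOdd p)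
    with allOdd p in p-odd | noOtE q
  ... | true  | true  rewrite #even-allOdd p p-odd = refl
  ... | true  | false = refl
  ... | false | _     = refl
  count-noOtE-shuffle-∷-∷ false true ea eb ih₁ _
    rewrite ih₁ | count-allOdd-shuffle (a ∷ p) q
          | noOtE-even-∷ a p ea | noOtE-odd-∷ b q eb | ea | eb
    with noOtE p | allOdd q in q-odd
  ... | true  | true  rewrite #even-allOdd q q-odd | nShuffles-zeroʳ (#even p) | nShuffles-zeroʳ (suc (#even p)) = ℕ.+-identityʳ _
  ... | true  | false = refl
  ... | false | _     = refl
  count-noOtE-shuffle-∷-∷ true true ea eb _ _
    rewrite count-allOdd-shuffle p (b ∷ q) | count-allOdd-shuffle (a ∷ p) q
          | noOtE-odd-∷ a p ea | noOtE-odd-∷ b q eb | ea | eb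
    with allOdd p in p-odd | allOdd q in q-odd
  ... | true  | true  rewrite #even-allOdd q q-odd | #odd-allOdd p p-odd | #odd-allOdd q q-odd | nShuffles-zeroʳ (#even p) = sym (ℕ.*-identityˡ _)
  ... | true  | false = refl
  ... | false | _     = refl

count-noOtE-shuffle : ∀ p q → count noOtE (shuffle p q) ≡
  (if noOtE p ∧ noOtE q then nShuffles (#even p) (#even q) ℕ.* nShuffles (#odd p) (#odd q) else 0)
count-noOtE-shuffle [] q with noOtE q
... | true  = refl
... | false = refl
count-noOtE-shuffle (a ∷ p) []
  rewrite ∧-identityʳ (noOtE (a ∷ p)) | nShuffles-zeroʳ (#even (a ∷ p)) | nShuffles-zeroʳ (#odd (a ∷ p))
  with noOtE (a ∷ p)
... | true  = refl
... | false = refl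
count-noOtE-shuffle (a ∷ p) (b ∷ q) = begin
  count noOtE (map (a ∷_) S₁ ++ map (b ∷_) S₂)
    ≡⟨ count-++ noOtE (map (a ∷_) S₁) (map (b ∷_) S₂) ⟩
  count noOtE (map (a ∷_) S₁) ℕ.+ count noOtE (map (b ∷_) S₂)
    ≡⟨ cong₂ ℕ._+_ (trans (count-map noOtE (a ∷_) S₁) (count-noOtE-∷ a S₁))
                   (trans (count-map noOtE (b ∷_) S₂) (count-noOtE-∷ b S₂)) ⟩
  (if isOdd a then count allOdd S₁ else count noOtE S₁) ℕ.+ (if isOdd b then count allOdd S₂ else count noOtE S₂)
    ≡⟨ count-noOtE-shuffle-∷-∷ a p b q (isOdd a) (isOdd b) refl refl (count-noOtE-shuffle p (b ∷ q)) (count-noOtE-shuffle (a ∷ p) q) ⟩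
  (if noOtE (a ∷ p) ∧ noOtE (b ∷ q)
     then nShuffles (#even (a ∷ p)) (#even (b ∷ q)) ℕ.* nShuffles (#odd (a ∷ p)) (#odd (b ∷ q)) else 0) ∎
  where
  open ≡-Reasoning
  S₁ S₂ : List (List ℕ)
  S₁ = shuffle p (b ∷ q)
  S₂ = shuffle (a ∷ p) q

module _ where
  open import Data.Integer.Base as ℤ using (+_)
  import Data.Integer.Properties as ℤ
  import Data.Rational.Base as ℚ
  import Data.Rational.Properties as ℚ
  import Data.Rational.Unnormalised.Base as ℚᵘ
  import Data.Rational.Unnormalised.Properties as ℚᵘ

  private
    toℚᵘ-/ : ∀ a b → ℚ.toℚᵘ (+ a / suc b) ℚᵘ.≃ ℚᵘ.mkℚᵘ (+ a) b
    toℚᵘ-/ a b = ℚ.toℚᵘ-fromℚᵘ (ℚᵘ.mkℚᵘ (+ a) b)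

  fromℕ : ℕ → ℚ
  fromℕ n = + n / 1

  cross-≡⇒/-≡ : ∀ a b c d .{{_ : ℕ.NonZero b}} .{{_ : ℕ.NonZero d}} → a ℕ.* d ≡ c ℕ.* b → + a / b ≡ + c / d
  cross-≡⇒/-≡ a (suc b) c (suc d) ad≡cb = ℚ.toℚᵘ-injective
    (ℚᵘ.≃-trans (toℚᵘ-/ a b) (ℚᵘ.≃-trans (ℚᵘ.*≡* ad≡cbᶻ) (ℚᵘ.≃-sym (toℚᵘ-/ c d))))
    where
    ad≡cbᶻ : + a ℤ.* + suc d ≡ + c ℤ.* + suc b
    ad≡cbᶻ = trans (sym (ℤ.pos-* a (suc d))) (trans (cong +_ ad≡cb) (ℤ.pos-* c (suc b)))

  /-*-/ : ∀ a b c d .{{_ : ℕ.NonZero b}} .{{_ : ℕ.NonZero d}} →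
    (+ a / b) * (+ c / d) ≡ _/_ (+ (a ℕ.* c)) (b ℕ.* d) {{ℕ.m*n≢0 b d}}
  /-*-/ a (suc b) c (suc d) = ℚ.toℚᵘ-injective
    (ℚᵘ.≃-trans (ℚ.toℚᵘ-homo-* (+ a / suc b) (+ c / suc d))
    (ℚᵘ.≃-trans (ℚᵘ.*-cong (toℚᵘ-/ a b) (toℚᵘ-/ c d))
    (ℚᵘ.≃-trans (ℚᵘ.*≡* (cong (ℤ._* + suc (d ℕ.+ b ℕ.* suc d)) (sym (ℤ.pos-* a c))))
    (ℚᵘ.≃-sym (toℚᵘ-/ (a ℕ.* c) (d ℕ.+ b ℕ.* suc d))))))

  fromℕ-suc : ∀ n → 1ℚ + fromℕ n ≡ fromℕ (suc n)
  fromℕ-suc n = ℚ.toℚᵘ-injective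
    (ℚᵘ.≃-trans (ℚ.toℚᵘ-homo-+ 1ℚ (fromℕ n))
    (ℚᵘ.≃-trans (ℚᵘ.+-cong (toℚᵘ-/ 1 0) (toℚᵘ-/ n 0))
    (ℚᵘ.≃-trans (ℚᵘ.*≡* 1+n≡suc-n) (ℚᵘ.≃-sym (toℚᵘ-/ (suc n) 0)))))
    where
    1+n≡suc-n : (+ 1 ℤ.* + 1 ℤ.+ + n ℤ.* + 1) ℤ.* + 1 ≡ + suc n ℤ.* + 1
    1+n≡suc-n = trans (ℤ.*-identityʳ _) (trans (cong (λ z → + 1 ℤ.+ z) (ℤ.*-identityʳ (+ n))) (sym (ℤ.*-identityʳ _)))

  oeCoeff : ℕ → ℕ → ℚ
  oeCoeff o e = (+ 1) / (o ! ℕ.* e !)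
    where instance _ = o ℕ.!* e !≢0

  nShuffles-*-oeCoeff : ∀ o₁ e₁ o₂ e₂ →
    fromℕ (nShuffles e₁ e₂ ℕ.* nShuffles o₁ o₂) * oeCoeff (o₁ ℕ.+ o₂) (e₁ ℕ.+ e₂) ≡ oeCoeff o₁ e₁ * oeCoeff o₂ e₂
  nShuffles-*-oeCoeff o₁ e₁ o₂ e₂ = begin
    fromℕ N * oeCoeff (o₁ ℕ.+ o₂) (e₁ ℕ.+ e₂) ≡⟨ /-*-/ N 1 1 D ⟩
    (+ (N ℕ.* 1)) / (1 ℕ.* D)                 ≡⟨ cross-≡⇒/-≡ (N ℕ.* 1) (1 ℕ.* D) (1 ℕ.* 1) (D₁ ℕ.* D₂) cross ⟩
    (+ (1 ℕ.* 1)) / (D₁ ℕ.* D₂)               ≡⟨ sym (/-*-/ 1 D₁ 1 D₂) ⟩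
    oeCoeff o₁ e₁ * oeCoeff o₂ e₂             ∎
    where
    open ≡-Reasoning
    Nₑ Nₒ N D D₁ D₂ : ℕ
    Nₑ = nShuffles e₁ e₂
    Nₒ = nShuffles o₁ o₂
    N  = Nₑ ℕ.* Nₒ
    D  = (o₁ ℕ.+ o₂) ! ℕ.* (e₁ ℕ.+ e₂) !
    D₁ = o₁ ! ℕ.* e₁ !
    D₂ = o₂ ! ℕ.* e₂ !
    instance
      _ = (o₁ ℕ.+ o₂) ℕ.!* (e₁ ℕ.+ e₂) !≢0
      _ = o₁ ℕ.!* e₁ !≢0
      _ = o₂ ℕ.!* e₂ !≢0
      _ = ℕ.m*n≢0 1 D
      _ = ℕ.m*n≢0 D₁ D₂
    regroup : ∀ x y a b c d → (x ℕ.* y ℕ.* 1) ℕ.* (a ℕ.* b ℕ.* (c ℕ.* d)) ≡ (x ℕ.* b ℕ.* d) ℕ.* (y ℕ.* a ℕ.* c)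
    regroup = solve-∀
    pad : ∀ x y → x ℕ.* y ≡ 1 ℕ.* 1 ℕ.* (1 ℕ.* (y ℕ.* x))
    pad = solve-∀
    cross : (N ℕ.* 1) ℕ.* (D₁ ℕ.* D₂) ≡ (1 ℕ.* 1) ℕ.* (1 ℕ.* D)
    cross = begin
      (N ℕ.* 1) ℕ.* (D₁ ℕ.* D₂)                            ≡⟨ regroup Nₑ Nₒ (o₁ !) (e₁ !) (o₂ !) (e₂ !) ⟩
      (Nₑ ℕ.* e₁ ! ℕ.* e₂ !) ℕ.* (Nₒ ℕ.* o₁ ! ℕ.* o₂ !)  ≡⟨ cong₂ ℕ._*_ (nShuffles-! e₁ e₂) (nShuffles-! o₁ o₂) ⟩
      (e₁ ℕ.+ e₂) ! ℕ.* (o₁ ℕ.+ o₂) !                      ≡⟨ pad ((e₁ ℕ.+ e₂) !) ((o₁ ℕ.+ o₂) !) ⟩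
      (1 ℕ.* 1) ℕ.* (1 ℕ.* D)                              ∎

Σ-when-const : {A : Set} (f : A → Bool) (xs : List A) (c : ℚ) → Σ[ xs ] (λ x → when (f x) c) ≡ fromℕ (count f xs) * c
Σ-when-const f []       c = sym (*-zeroˡ c)
Σ-when-const f (x ∷ xs) c with f x
... | true  = begin
  c + Σ[ xs ] (λ x → when (f x) c)   ≡⟨ cong₂ _+_ (sym (*-identityˡ c)) (Σ-when-const f xs c) ⟩
  1ℚ * c + fromℕ (count f xs) * c    ≡⟨ sym (*-distribʳ-+ c 1ℚ (fromℕ (count f xs))) ⟩
  (1ℚ + fromℕ (count f xs)) * c      ≡⟨ cong (_* c) (fromℕ-suc (count f xs)) ⟩
  fromℕ (suc (count f xs)) * c       ∎
  where open ≡-Reasoning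
... | false = trans (+-identityˡ _) (Σ-when-const f xs c)

blockWeight : List ℕ → ℚ
blockWeight u = when (noOtE u) (blockCoeff u)

Σ-shuffle-blockWeight : ∀ p q → Σ[ shuffle p q ] blockWeight ≡ blockWeight p * blockWeight q
Σ-shuffle-blockWeight p q = begin
  Σ[ shuffle p q ] blockWeight
    ≡⟨ Σ-cong-All (All.zipWith (λ { {r} (#odd≡ , #even≡) → cong (when (noOtE r)) (cong₂ oeCoeff #odd≡ #even≡) })
                               (count-shuffle isOdd p q , count-shuffle isEven p q)) ⟩
  Σ[ shuffle p q ] (λ r → when (noOtE r) c)
    ≡⟨ Σ-when-const noOtE (shuffle p q) c ⟩
  fromℕ (count noOtE (shuffle p q)) * c
    ≡⟨ cong (λ n → fromℕ n * c) (count-noOtE-shuffle p q) ⟩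
  fromℕ (if noOtE p ∧ noOtE q then nShuffles (#even p) (#even q) ℕ.* nShuffles (#odd p) (#odd q) else 0) * c
    ≡⟨ by-cases (noOtE p ∧ noOtE q) ⟩
  when (noOtE p ∧ noOtE q) (blockCoeff p * blockCoeff q)
    ≡⟨ sym (when-*-when (noOtE p) (noOtE q) (blockCoeff p) (blockCoeff q)) ⟩
  blockWeight p * blockWeight q ∎
  where
  open ≡-Reasoning
  c : ℚ
  c = oeCoeff (#odd p ℕ.+ #odd q) (#even p ℕ.+ #even q)
  by-cases : ∀ b → fromℕ (if b then nShuffles (#even p) (#even q) ℕ.* nShuffles (#odd p) (#odd q) else 0) * c ≡
                   when b (blockCoeff p * blockCoeff q)
  by-cases true  = nShuffles-*-oeCoeff (#odd p) (#even p) (#odd q) (#even q)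
  by-cases false = *-zeroˡ c

blockWeightAt : ℕ → List ℕ → ℚ
blockWeightAt k u = when (k ≡ᵇ sumℕ u) (blockWeight u)

Σ-shuffle-blockWeightAt : ∀ n u u′ →
  Σ[ shuffle u u′ ] (blockWeightAt n) ≡ when (n ≡ᵇ sumℕ u ℕ.+ sumℕ u′) (blockWeight u * blockWeight u′)
Σ-shuffle-blockWeightAt n u u′ = begin
  Σ[ shuffle u u′ ] (blockWeightAt n)
    ≡⟨ Σ-cong-All (All.map (λ {r} sum≡ → cong (λ m → when (n ≡ᵇ m) (blockWeight r)) sum≡) (sum-shuffle u u′)) ⟩
  Σ[ shuffle u u′ ] (λ r → when (n ≡ᵇ sumℕ u ℕ.+ sumℕ u′) (blockWeight r))
    ≡⟨ Σ-when (shuffle u u′) (n ≡ᵇ sumℕ u ℕ.+ sumℕ u′) blockWeight ⟩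
  when (n ≡ᵇ sumℕ u ℕ.+ sumℕ u′) (Σ[ shuffle u u′ ] blockWeight)
    ≡⟨ cong (when (n ≡ᵇ sumℕ u ℕ.+ sumℕ u′)) (Σ-shuffle-blockWeight u u′) ⟩
  when (n ≡ᵇ sumℕ u ℕ.+ sumℕ u′) (blockWeight u * blockWeight u′) ∎
  where open ≡-Reasoning

-- Deconcatenation

cuts : List ℕ → List (List ℕ × List ℕ)
cuts []      = ([] , []) ∷ []
cuts (a ∷ γ) = ([] , a ∷ γ) ∷ map (map₁ (a ∷_)) (cuts γ)

Σ-cuts-∷ : ∀ a γ (h : List ℕ × List ℕ → ℚ) → Σ[ cuts (a ∷ γ) ] h ≡ h ([] , a ∷ γ) + Σ[ cuts γ ] (λ x → h (map₁ (a ∷_) x))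
Σ-cuts-∷ a γ h = cong (h ([] , a ∷ γ) +_) (Σ-map (cuts γ) (map₁ (a ∷_)) h)

cuts-composition : ∀ {α} → IsComposition α → All (λ (u , v) → IsComposition v) (cuts α)
cuts-composition {[]}    []         = [] ∷ []
cuts-composition {a ∷ α} (ca ∷ cα) = (ca ∷ cα) ∷ All.map⁺ (cuts-composition cα)

Σ-shuffle-[]ˡ : ∀ q (f : List ℕ → ℚ) → Σ[ shuffle [] q ] f ≡ f q
Σ-shuffle-[]ˡ q f = +-identityʳ (f q)

Σ-shuffle-[]ʳ : ∀ p (f : List ℕ → ℚ) → Σ[ shuffle p [] ] f ≡ f p
Σ-shuffle-[]ʳ []      f = +-identityʳ (f [])
Σ-shuffle-[]ʳ (a ∷ p) f = +-identityʳ (f (a ∷ p))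

Σ-shuffle-∷-∷ : ∀ a p b q (f : List ℕ → ℚ) →
  Σ[ shuffle (a ∷ p) (b ∷ q) ] f ≡ Σ[ shuffle p (b ∷ q) ] (λ r → f (a ∷ r)) + Σ[ shuffle (a ∷ p) q ] (λ r → f (b ∷ r))
Σ-shuffle-∷-∷ a p b q f = trans (Σ-++ (map (a ∷_) (shuffle p (b ∷ q))) (map (b ∷_) (shuffle (a ∷ p) q)) f)
  (cong₂ _+_ (Σ-map (shuffle p (b ∷ q)) (a ∷_) f) (Σ-map (shuffle (a ∷ p) q) (b ∷_) f))

Σ-shuffle² : (List ℕ × List ℕ → ℚ) → List ℕ × List ℕ → List ℕ × List ℕ → ℚ
Σ-shuffle² h (u , v) (u′ , v′) = Σ[ shuffle u u′ ] (λ r → Σ[ shuffle v v′ ] (λ s → h (r , s)))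

Σ-shuffle²-[]ʳ : ∀ h x → Σ-shuffle² h x ([] , []) ≡ h x
Σ-shuffle²-[]ʳ h (u , v) = trans (Σ-shuffle-[]ʳ u (λ r → Σ[ shuffle v [] ] (λ s → h (r , s)))) (Σ-shuffle-[]ʳ v (λ s → h (u , s)))

Σ-shuffle²-[]ˡ : ∀ h y → Σ-shuffle² h ([] , []) y ≡ h y
Σ-shuffle²-[]ˡ h (u , v) = trans (Σ-shuffle-[]ˡ u (λ r → Σ[ shuffle [] v ] (λ s → h (r , s)))) (Σ-shuffle-[]ˡ v (λ s → h (u , s)))

Σ-shuffle²-∷-∷ : ∀ h a u v b u′ v′ →
  Σ-shuffle² h (a ∷ u , v) (b ∷ u′ , v′) ≡
  Σ-shuffle² (λ x → h (map₁ (a ∷_) x)) (u , v) (b ∷ u′ , v′) + Σ-shuffle² (λ x → h (map₁ (b ∷_) x)) (a ∷ u , v) (u′ , v′)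
Σ-shuffle²-∷-∷ h a u v b u′ v′ = Σ-shuffle-∷-∷ a u b u′ (λ r → Σ[ shuffle v v′ ] (λ s → h (r , s)))

Σ-shuffle²-∷-[] : ∀ h a u v v′ →
  Σ-shuffle² h (a ∷ u , v) ([] , v′) ≡ Σ-shuffle² (λ x → h (map₁ (a ∷_) x)) (u , v) ([] , v′)
Σ-shuffle²-∷-[] h a u v v′ = trans (+-identityʳ _) (sym (Σ-shuffle-[]ʳ u (λ r → Σ[ shuffle v v′ ] (λ s → h (a ∷ r , s)))))

shuffle-cuts : ∀ α β (h : List ℕ × List ℕ → ℚ) →
  Σ[ shuffle α β ] (λ γ → Σ[ cuts γ ] h) ≡ Σ[ cuts α ] (λ x → Σ[ cuts β ] (Σ-shuffle² h x))
shuffle-cuts [] β h = trans (+-identityʳ _) (sym (trans (+-identityʳ _) (Σ-cong (cuts β) (Σ-shuffle²-[]ˡ h))))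
shuffle-cuts (a ∷ α₁) [] h = trans (+-identityʳ _)
  (sym (Σ-cong (cuts (a ∷ α₁)) (λ x → trans (+-identityʳ _) (Σ-shuffle²-[]ʳ h x))))
shuffle-cuts (a ∷ α₁) (b ∷ β₁) h = begin
  Σ[ shuffle α β ] (λ γ → Σ[ cuts γ ] h)
    ≡⟨ Σ-shuffle-∷-∷ a α₁ b β₁ (λ γ → Σ[ cuts γ ] h) ⟩
  Σ[ shuffle α₁ β ] (λ γ → Σ[ cuts (a ∷ γ) ] h) + Σ[ shuffle α β₁ ] (λ γ → Σ[ cuts (b ∷ γ) ] h)
    ≡⟨ cong₂ _+_ (trans (Σ-cong (shuffle α₁ β) (λ γ → Σ-cuts-∷ a γ h)) (Σ-+ (shuffle α₁ β) _ _))
                 (trans (Σ-cong (shuffle α β₁) (λ γ → Σ-cuts-∷ b γ h)) (Σ-+ (shuffle α β₁) _ _)) ⟩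
  (Eᵃ + Σ[ shuffle α₁ β ] (λ γ → Σ[ cuts γ ] hᵃ)) + (Eᵇ + Σ[ shuffle α β₁ ] (λ γ → Σ[ cuts γ ] hᵇ))
    ≡⟨ cong₂ (λ u v → (Eᵃ + u) + (Eᵇ + v)) (shuffle-cuts α₁ (b ∷ β₁) hᵃ) (shuffle-cuts (a ∷ α₁) β₁ hᵇ) ⟩
  (Eᵃ + Σ[ cuts α₁ ] (λ x → Σ[ cuts β ] (Σ-shuffle² hᵃ x))) + (Eᵇ + Σ[ cuts α ] (λ x → Σ[ cuts β₁ ] (Σ-shuffle² hᵇ x)))
    ≡⟨ cong₂ (λ u v → (Eᵃ + u) + (Eᵇ + v)) cutsᵃ cutsᵇ ⟩
  (Eᵃ + (Cᵃ + Xᵃ)) + (Eᵇ + (Cᵇ + Xᵇ))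
    ≡⟨ regroup Eᵃ Eᵇ Cᵃ Cᵇ Xᵃ Xᵇ ⟩
  ((Eᵃ + Eᵇ) + Cᵇ) + (Cᵃ + (Xᵃ + Xᵇ))
    ≡⟨ sym (cong₂ _+_ cutsα-empty cutsα-∷) ⟩
  Σ[ cuts β ] (Σ-shuffle² h ([] , α)) + Σ[ cuts α₁ ] (λ x → Σ[ cuts β ] (Σ-shuffle² h (map₁ (a ∷_) x)))
    ≡⟨ sym (Σ-cuts-∷ a α₁ (λ x → Σ[ cuts β ] (Σ-shuffle² h x))) ⟩
  Σ[ cuts α ] (λ x → Σ[ cuts β ] (Σ-shuffle² h x)) ∎
  where
  open ≡-Reasoning
  α β : List ℕ
  α = a ∷ α₁
  β = b ∷ β₁
  hᵃ hᵇ : List ℕ × List ℕ → ℚ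
  hᵃ x = h (map₁ (a ∷_) x)
  hᵇ x = h (map₁ (b ∷_) x)
  Eᵃ Eᵇ Cᵃ Cᵇ Xᵃ Xᵇ : ℚ
  Eᵃ = Σ[ shuffle α₁ β ] (λ γ → h ([] , a ∷ γ))
  Eᵇ = Σ[ shuffle α β₁ ] (λ γ → h ([] , b ∷ γ))
  Cᵃ = Σ[ cuts α₁ ] (λ x → Σ-shuffle² h (map₁ (a ∷_) x) ([] , β))
  Cᵇ = Σ[ cuts β₁ ] (λ y → Σ-shuffle² h ([] , α) (map₁ (b ∷_) y))
  Xᵃ = Σ[ cuts α₁ ] (λ x → Σ[ cuts β₁ ] (λ y → Σ-shuffle² hᵃ x (map₁ (b ∷_) y)))
  Xᵇ = Σ[ cuts α₁ ] (λ x → Σ[ cuts β₁ ] (λ y → Σ-shuffle² hᵇ (map₁ (a ∷_) x) y))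
  regroup : ∀ x₁ x₂ x₃ x₄ x₅ x₆ → (x₁ + (x₃ + x₅)) + (x₂ + (x₄ + x₆)) ≡ ((x₁ + x₂) + x₄) + (x₃ + (x₅ + x₆))
  regroup = solve 6 (λ x₁ x₂ x₃ x₄ x₅ x₆ →
    (x₁ ⊕ (x₃ ⊕ x₅)) ⊕ (x₂ ⊕ (x₄ ⊕ x₆)) ⊜ ((x₁ ⊕ x₂) ⊕ x₄) ⊕ (x₃ ⊕ (x₅ ⊕ x₆))) refl
    where open import Algebra.Solver.CommutativeMonoid +-0-commutativeMonoid using (solve; _⊜_; _⊕_)
  cutsᵃ : Σ[ cuts α₁ ] (λ x → Σ[ cuts β ] (Σ-shuffle² hᵃ x)) ≡ Cᵃ + Xᵃ
  cutsᵃ = trans (Σ-cong (cuts α₁) (λ x → trans (Σ-cuts-∷ b β₁ (Σ-shuffle² hᵃ x))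
                                               (cong (_+ Σ[ cuts β₁ ] (λ y → Σ-shuffle² hᵃ x (map₁ (b ∷_) y)))
                                                     (sym (Σ-shuffle²-∷-[] h a (proj₁ x) (proj₂ x) β)))))
                (Σ-+ (cuts α₁) _ _)
  cutsᵇ : Σ[ cuts α ] (λ x → Σ[ cuts β₁ ] (Σ-shuffle² hᵇ x)) ≡ Cᵇ + Xᵇ
  cutsᵇ = Σ-cuts-∷ a α₁ (λ x → Σ[ cuts β₁ ] (Σ-shuffle² hᵇ x))
  cutsα-empty : Σ[ cuts β ] (Σ-shuffle² h ([] , α)) ≡ (Eᵃ + Eᵇ) + Cᵇ
  cutsα-empty = trans (Σ-cuts-∷ b β₁ (Σ-shuffle² h ([] , α)))
    (cong (_+ Cᵇ) (trans (+-identityʳ (Σ[ shuffle α β ] (λ s → h ([] , s)))) (Σ-shuffle-∷-∷ a α₁ b β₁ (λ s → h ([] , s)))))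
  cutsα-∷ : Σ[ cuts α₁ ] (λ x → Σ[ cuts β ] (Σ-shuffle² h (map₁ (a ∷_) x))) ≡ Cᵃ + (Xᵃ + Xᵇ)
  cutsα-∷ = begin
    Σ[ cuts α₁ ] (λ x → Σ[ cuts β ] (Σ-shuffle² h (map₁ (a ∷_) x)))
      ≡⟨ Σ-cong (cuts α₁) (λ x → Σ-cuts-∷ b β₁ (Σ-shuffle² h (map₁ (a ∷_) x))) ⟩
    Σ[ cuts α₁ ] (λ x → Σ-shuffle² h (map₁ (a ∷_) x) ([] , β) +
                        Σ[ cuts β₁ ] (λ y → Σ-shuffle² h (map₁ (a ∷_) x) (map₁ (b ∷_) y)))
      ≡⟨ Σ-cong (cuts α₁) (λ x → cong (Σ-shuffle² h (map₁ (a ∷_) x) ([] , β) +_)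
           (trans (Σ-cong (cuts β₁) (λ y → Σ-shuffle²-∷-∷ h a (proj₁ x) (proj₂ x) b (proj₁ y) (proj₂ y))) (Σ-+ (cuts β₁) _ _))) ⟩
    Σ[ cuts α₁ ] (λ x → Σ-shuffle² h (map₁ (a ∷_) x) ([] , β) +
                        (Σ[ cuts β₁ ] (λ y → Σ-shuffle² hᵃ x (map₁ (b ∷_) y)) + Σ[ cuts β₁ ] (Σ-shuffle² hᵇ (map₁ (a ∷_) x))))
      ≡⟨ trans (Σ-+ (cuts α₁) _ _) (cong (Cᵃ +_) (Σ-+ (cuts α₁) _ _)) ⟩
    Cᵃ + (Xᵃ + Xᵇ) ∎

-- The shuffle basis expanded along its first block

·ₛ-∷ : ∀ (f g : Series) n e →
  (f ·ₛ g) (n ∷ e) ≡ Σ[ upTo (suc n) ] (λ k → Σ[ splits e ] (λ (d , d′) → f (k ∷ d) * g (n ℕ.∸ k ∷ d′)))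
·ₛ-∷ f g n e = trans (Σ-concatMap (upTo (suc n)) split-at (λ (d , d′) → f d * g d′))
  (Σ-cong (upTo (suc n)) (λ k → Σ-map (splits e) (λ (d , d′) → (k ∷ d , n ℕ.∸ k ∷ d′)) (λ (d , d′) → f d * g d′)))
  where
  split-at : ℕ → List (List ℕ × List ℕ)
  split-at k = map (λ (d , d′) → (k ∷ d , n ℕ.∸ k ∷ d′)) (splits e)

firstBlock : ℕ → (List ℕ → ℚ) → List ℕ × List ℕ → ℚ
firstBlock k g (u , v) = blockWeightAt k u * g v

-- S α (k ∷ d) expanded along the first block u (no OtE, sum k); the empty block accounts for a zero exponent.
Ŝ : List ℕ → List ℕ → ℚ
Ŝ α       (k ∷ d) = Σ[ cuts α ] (firstBlock k (λ v → Ŝ v d))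
Ŝ []      []      = 1ℚ
Ŝ (_ ∷ _) []      = 0ℚ

Ŝ-zero-∷ : ∀ α → IsComposition α → ∀ d → Ŝ α (0 ∷ d) ≡ Ŝ α d
Ŝ-zero-∷ []           _ d = trans (+-identityʳ _) (*-identityˡ (Ŝ [] d))
Ŝ-zero-∷ (zero ∷ as)  (() ∷ _)
Ŝ-zero-∷ (suc a ∷ as) _ d = begin
  Ŝ (suc a ∷ as) (0 ∷ d)
    ≡⟨ Σ-cuts-∷ (suc a) as (firstBlock 0 (λ v → Ŝ v d)) ⟩
  1ℚ * Ŝ (suc a ∷ as) d + Σ[ cuts as ] (λ x → firstBlock 0 (λ v → Ŝ v d) (map₁ (suc a ∷_) x))
    ≡⟨ cong (1ℚ * Ŝ (suc a ∷ as) d +_) (trans (Σ-cong (cuts as) (λ (u , v) → *-zeroˡ (Ŝ v d))) (Σ-zero (cuts as))) ⟩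
  1ℚ * Ŝ (suc a ∷ as) d + 0ℚ
    ≡⟨ trans (+-identityʳ _) (*-identityˡ _) ⟩
  Ŝ (suc a ∷ as) d ∎
  where open ≡-Reasoning

Ŝ-∷-suc : ∀ a as k d → Ŝ (a ∷ as) (suc k ∷ d) ≡ Σ[ cuts as ] (λ x → firstBlock (suc k) (λ v → Ŝ v d) (map₁ (a ∷_) x))
Ŝ-∷-suc a as k d = begin
  Ŝ (a ∷ as) (suc k ∷ d)
    ≡⟨ Σ-cuts-∷ a as (firstBlock (suc k) (λ v → Ŝ v d)) ⟩
  0ℚ * Ŝ (a ∷ as) d + Σ[ cuts as ] (λ x → firstBlock (suc k) (λ v → Ŝ v d) (map₁ (a ∷_) x))
    ≡⟨ cong (_+ Σ[ cuts as ] (λ x → firstBlock (suc k) (λ v → Ŝ v d) (map₁ (a ∷_) x))) (*-zeroˡ (Ŝ (a ∷ as) d)) ⟩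
  0ℚ + Σ[ cuts as ] (λ x → firstBlock (suc k) (λ v → Ŝ v d) (map₁ (a ∷_) x))
    ≡⟨ +-identityˡ _ ⟩
  Σ[ cuts as ] (λ x → firstBlock (suc k) (λ v → Ŝ v d) (map₁ (a ∷_) x)) ∎
  where open ≡-Reasoning

Ŝ-product : ∀ e α β → (Ŝ α ·ₛ Ŝ β) e ≡ Σ[ shuffle α β ] (λ γ → Ŝ γ e)
Ŝ-product []      []      β       = cong (_+ 0ℚ) (*-identityˡ (Ŝ β []))
Ŝ-product []      (a ∷ α) []      = refl
Ŝ-product []      (a ∷ α) (b ∷ β) =
  sym (trans (Σ-shuffle-∷-∷ a α b β (λ γ → Ŝ γ [])) (cong₂ _+_ (Σ-zero (shuffle α (b ∷ β))) (Σ-zero (shuffle (a ∷ α) β))))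
Ŝ-product (n ∷ e) α       β       = begin
  (Ŝ α ·ₛ Ŝ β) (n ∷ e)
    ≡⟨ ·ₛ-∷ (Ŝ α) (Ŝ β) n e ⟩
  Σ[ upTo (suc n) ] (λ k → Σ[ splits e ] (λ (d , d′) → Ŝ α (k ∷ d) * Ŝ β (n ℕ.∸ k ∷ d′)))
    ≡⟨ Σ-cong (upTo (suc n)) (λ k → Σ-*-Σ-interchange (splits e) (cuts α) (cuts β) _ _) ⟩
  Σ[ upTo (suc n) ] (λ k → Σ[ cuts α ] (λ x → Σ[ cuts β ] (λ y → Σ[ splits e ] (term k x y))))
    ≡⟨ Σ-swap₂ (upTo (suc n)) (cuts α) (cuts β) (λ k x y → Σ[ splits e ] (term k x y)) ⟩
  Σ[ cuts α ] (λ x → Σ[ cuts β ] (λ y → Σ[ upTo (suc n) ] (λ k → Σ[ splits e ] (term k x y))))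
    ≡⟨ Σ-cong (cuts α) (λ x → Σ-cong (cuts β) (λ y → factor x y)) ⟩
  Σ[ cuts α ] (λ x → Σ[ cuts β ] (Σ-shuffle² h x))
    ≡⟨ sym (shuffle-cuts α β h) ⟩
  Σ[ shuffle α β ] (λ γ → Ŝ γ (n ∷ e)) ∎
  where
  open ≡-Reasoning
  open import Algebra.Properties.CommutativeSemigroup (CommutativeMonoid.commutativeSemigroup *-1-commutativeMonoid)
    using (interchange)
  term : ℕ → List ℕ × List ℕ → List ℕ × List ℕ → List ℕ × List ℕ → ℚ
  term k x y (d , d′) = firstBlock k (λ v → Ŝ v d) x * firstBlock (n ℕ.∸ k) (λ v′ → Ŝ v′ d′) y
  h : List ℕ × List ℕ → ℚ
  h = firstBlock n (λ s → Ŝ s e)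
  factor : ∀ x y → Σ[ upTo (suc n) ] (λ k → Σ[ splits e ] (term k x y)) ≡ Σ-shuffle² h x y
  factor (u , v) (u′ , v′) = begin
    Σ[ upTo (suc n) ] (λ k → Σ[ splits e ] (term k (u , v) (u′ , v′)))
      ≡⟨ Σ-cong (upTo (suc n)) (λ k → Σ-cong (splits e) (λ (d , d′) →
           interchange (blockWeightAt k u) (Ŝ v d) (blockWeightAt (n ℕ.∸ k) u′) (Ŝ v′ d′))) ⟩
    Σ[ upTo (suc n) ] (λ k → Σ[ splits e ] (λ (d , d′) → (blockWeightAt k u * blockWeightAt (n ℕ.∸ k) u′) * (Ŝ v d * Ŝ v′ d′)))
      ≡⟨ sym (Σ-*-Σ (upTo (suc n)) (splits e) (λ k → blockWeightAt k u * blockWeightAt (n ℕ.∸ k) u′)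
                                              (λ (d , d′) → Ŝ v d * Ŝ v′ d′)) ⟩
    Σ[ upTo (suc n) ] (λ k → blockWeightAt k u * blockWeightAt (n ℕ.∸ k) u′) * (Ŝ v ·ₛ Ŝ v′) e
      ≡⟨ cong₂ _*_ convolve (Ŝ-product e v v′) ⟩
    when (n ≡ᵇ sumℕ u ℕ.+ sumℕ u′) (blockWeight u * blockWeight u′) * Σ[ shuffle v v′ ] (λ s → Ŝ s e)
      ≡⟨ cong (_* Σ[ shuffle v v′ ] (λ s → Ŝ s e)) (sym (Σ-shuffle-blockWeightAt n u u′)) ⟩
    Σ[ shuffle u u′ ] (blockWeightAt n) * Σ[ shuffle v v′ ] (λ s → Ŝ s e)
      ≡⟨ Σ-*-Σ (shuffle u u′) (shuffle v v′) (blockWeightAt n) (λ s → Ŝ s e) ⟩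
    Σ-shuffle² h (u , v) (u′ , v′) ∎
    where
    convolve : Σ[ upTo (suc n) ] (λ k → blockWeightAt k u * blockWeightAt (n ℕ.∸ k) u′) ≡
               when (n ≡ᵇ sumℕ u ℕ.+ sumℕ u′) (blockWeight u * blockWeight u′)
    convolve = trans (Σ-cong (upTo (suc n)) (λ k → when-*-when (k ≡ᵇ sumℕ u) (n ℕ.∸ k ≡ᵇ sumℕ u′) (blockWeight u) (blockWeight u′)))
                     (Σ-upTo-convolution n (sumℕ u) (sumℕ u′) (blockWeight u * blockWeight u′))

prependBlock : ℕ → List (List ℕ) → List (List (List ℕ))
prependBlock a []       = ((a ∷ []) ∷ []) ∷ []
prependBlock a (b ∷ bs) = ((a ∷ []) ∷ b ∷ bs) ∷ ((a ∷ b) ∷ bs) ∷ []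

blockings-∷ : ∀ a as → blockings (a ∷ as) ≡ concatMap (prependBlock a) (blockings as)
blockings-∷ a as = List.concatMap-cong (λ { [] → refl ; (b ∷ bs) → refl }) (blockings as)

Σ-blockings-∷ : ∀ a as (f : List (List ℕ) → ℚ) →
  Σ[ blockings (a ∷ as) ] f ≡ Σ[ cuts as ] (λ (u , v) → Σ[ blockings v ] (λ bs → f ((a ∷ u) ∷ bs)))
Σ-blockings-∷ a []        f = sym (+-identityʳ (f ((a ∷ []) ∷ []) + 0ℚ))
Σ-blockings-∷ a (b ∷ as₁) f = begin
  Σ[ blockings (a ∷ b ∷ as₁) ] f
    ≡⟨ cong (Σ[_] f) (blockings-∷ a (b ∷ as₁)) ⟩
  Σ[ concatMap (prependBlock a) (blockings (b ∷ as₁)) ] f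
    ≡⟨ Σ-concatMap (blockings (b ∷ as₁)) (prependBlock a) f ⟩
  Σ[ blockings (b ∷ as₁) ] (λ cs → Σ[ prependBlock a cs ] f)
    ≡⟨ Σ-blockings-∷ b as₁ (λ cs → Σ[ prependBlock a cs ] f) ⟩
  Σ[ cuts as₁ ] (λ (u , v) → Σ[ blockings v ] (λ cs → f ((a ∷ []) ∷ (b ∷ u) ∷ cs) + (f ((a ∷ b ∷ u) ∷ cs) + 0ℚ)))
    ≡⟨ Σ-cong (cuts as₁) (λ (u , v) → trans (Σ-cong (blockings v) (λ cs → cong (f ((a ∷ []) ∷ (b ∷ u) ∷ cs) +_) (+-identityʳ _)))
                                            (Σ-+ (blockings v) _ _)) ⟩
  Σ[ cuts as₁ ] (λ (u , v) → Σ[ blockings v ] (λ cs → f ((a ∷ []) ∷ (b ∷ u) ∷ cs)) +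
                             Σ[ blockings v ] (λ cs → f ((a ∷ b ∷ u) ∷ cs)))
    ≡⟨ Σ-+ (cuts as₁) _ _ ⟩
  Σ[ cuts as₁ ] (λ (u , v) → Σ[ blockings v ] (λ cs → f ((a ∷ []) ∷ (b ∷ u) ∷ cs))) + merged
    ≡⟨ cong (_+ merged) (sym (Σ-blockings-∷ b as₁ (λ cs → f ((a ∷ []) ∷ cs)))) ⟩
  Σ[ blockings (b ∷ as₁) ] (λ cs → f ((a ∷ []) ∷ cs)) + merged
    ≡⟨ sym (Σ-cuts-∷ b as₁ (λ (u , v) → Σ[ blockings v ] (λ cs → f ((a ∷ u) ∷ cs)))) ⟩
  Σ[ cuts (b ∷ as₁) ] (λ (u , v) → Σ[ blockings v ] (λ bs → f ((a ∷ u) ∷ bs))) ∎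
  where
  open ≡-Reasoning
  merged : ℚ
  merged = Σ[ cuts as₁ ] (λ (u , v) → Σ[ blockings v ] (λ cs → f ((a ∷ b ∷ u) ∷ cs)))

blockingWeight : List (List ℕ) → ℚ
blockingWeight bs = prodℚ (map blockWeight bs)

Sᵇ : List ℕ → Series
Sᵇ α e = Σ[ blockings α ] (λ bs → blockingWeight bs * M (map sumℕ bs) e)

M-∷-suc : ∀ x xs k d → M (x ∷ xs) (suc k ∷ d) ≡ when (suc k ≡ᵇ x) (M xs d)
M-∷-suc x xs k d with suc k ≡ᵇ x
... | true  = refl
... | false = refl

Σ-blockings-firstBlock : ∀ k d u v →
  Σ[ blockings v ] (λ bs → blockingWeight (u ∷ bs) * M (map sumℕ (u ∷ bs)) (suc k ∷ d)) ≡ firstBlock (suc k) (λ v → Sᵇ v d) (u , v)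
Σ-blockings-firstBlock k d u v = begin
  Σ[ blockings v ] (λ bs → (blockWeight u * blockingWeight bs) * M (sumℕ u ∷ map sumℕ bs) (suc k ∷ d))
    ≡⟨ Σ-cong (blockings v) (λ bs → trans (cong ((blockWeight u * blockingWeight bs) *_) (M-∷-suc (sumℕ u) (map sumℕ bs) k d))
                                          (regroup (suc k ≡ᵇ sumℕ u) (blockWeight u) (blockingWeight bs) (M (map sumℕ bs) d))) ⟩
  Σ[ blockings v ] (λ bs → blockWeightAt (suc k) u * (blockingWeight bs * M (map sumℕ bs) d))
    ≡⟨ Σ-*ˡ (blockings v) (blockWeightAt (suc k) u) _ ⟩
  firstBlock (suc k) (λ v → Sᵇ v d) (u , v) ∎
  where
  open ≡-Reasoning
  regroup : ∀ c x y z → (x * y) * when c z ≡ when c x * (y * z)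
  regroup true  x y z = *-assoc x y z
  regroup false x y z = trans (*-zeroʳ (x * y)) (sym (*-zeroˡ (y * z)))

Sᵇ≡Ŝ : ∀ e α → IsComposition α → Sᵇ α e ≡ Ŝ α e
Sᵇ≡Ŝ []          []       _ = refl
Sᵇ≡Ŝ []          (a ∷ as) _ = trans (Σ-blockings-∷ a as _)
  (trans (Σ-cong (cuts as) (λ (u , v) → trans (Σ-cong (blockings v) (λ bs → *-zeroʳ (blockingWeight ((a ∷ u) ∷ bs))))
                                               (Σ-zero (blockings v))))
         (Σ-zero (cuts as)))
Sᵇ≡Ŝ (zero ∷ d)  α        cα = trans (Sᵇ≡Ŝ d α cα) (sym (Ŝ-zero-∷ α cα d))
Sᵇ≡Ŝ (suc k ∷ d) []       _ = sym (trans (+-identityʳ _) (*-zeroˡ (Ŝ [] d)))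
Sᵇ≡Ŝ (suc k ∷ d) (a ∷ as) (ca ∷ cas) = begin
  Sᵇ (a ∷ as) (suc k ∷ d)
    ≡⟨ Σ-blockings-∷ a as _ ⟩
  Σ[ cuts as ] (λ (u , v) → Σ[ blockings v ] (λ bs → blockingWeight ((a ∷ u) ∷ bs) * M (map sumℕ ((a ∷ u) ∷ bs)) (suc k ∷ d)))
    ≡⟨ Σ-cong (cuts as) (λ (u , v) → Σ-blockings-firstBlock k d (a ∷ u) v) ⟩
  Σ[ cuts as ] (λ x → firstBlock (suc k) (λ v → Sᵇ v d) (map₁ (a ∷_) x))
    ≡⟨ Σ-cong-All (All.map (λ {x} cv → cong (blockWeightAt (suc k) (a ∷ proj₁ x) *_)
                                            (Sᵇ≡Ŝ d (proj₂ x) cv))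
                           (cuts-composition cas)) ⟩
  Σ[ cuts as ] (λ x → firstBlock (suc k) (λ v → Ŝ v d) (map₁ (a ∷_) x))
    ≡⟨ sym (Ŝ-∷-suc a as k d) ⟩
  Ŝ (a ∷ as) (suc k ∷ d) ∎
  where open ≡-Reasoning

-- The range m_o(α) ≤ β ≤ α of the shuffle basis

_⊆ᵇ_ : List ℕ → List ℕ → Bool
X ⊆ᵇ Y = allᵇ (_∈ᵇ Y) X

Positive : List ℕ → Set
Positive = All (0 ℕ.<_)

partialSumsFrom-+ : ∀ a b xs → partialSumsFrom (a ℕ.+ b) xs ≡ map (a ℕ.+_) (partialSumsFrom b xs)
partialSumsFrom-+ a b []       = refl
partialSumsFrom-+ a b (x ∷ xs) rewrite ℕ.+-assoc a b x = cong (a ℕ.+ (b ℕ.+ x) ∷_) (partialSumsFrom-+ a (b ℕ.+ x) xs)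

partialSums-∷ : ∀ a xs → partialSums (a ∷ xs) ≡ a ∷ map (a ℕ.+_) (partialSums xs)
partialSums-∷ a xs = cong (a ∷_) (trans (cong (λ z → partialSumsFrom z xs) (sym (ℕ.+-identityʳ a))) (partialSumsFrom-+ a 0 xs))

map-+-positive : ∀ {a} → 0 ℕ.< a → ∀ ys → Positive (map (a ℕ.+_) ys)
map-+-positive {a} 0<a ys = All.map⁺ (All.universal (λ y → ℕ.<-≤-trans 0<a (ℕ.m≤m+n a y)) ys)

partialSums-∷-positive : ∀ {x} → 0 ℕ.< x → ∀ xs → Positive (partialSums (x ∷ xs))
partialSums-∷-positive {x} 0<x xs = subst Positive (sym (partialSums-∷ x xs)) (0<x ∷ map-+-positive 0<x (partialSums xs))

module _ (a : ℕ) where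

  ≡ᵇ-+ˡ : ∀ x y → (a ℕ.+ x ≡ᵇ a ℕ.+ y) ≡ (x ≡ᵇ y)
  ≡ᵇ-+ˡ x y = does-≡ (map′ (ℕ.+-cancelˡ-≡ a x y) (cong (a ℕ.+_)) (a ℕ.+ x ℕ.≟ a ℕ.+ y)) (x ℕ.≟ y)

  ∈ᵇ-map-+ : ∀ x ys → (a ℕ.+ x) ∈ᵇ map (a ℕ.+_) ys ≡ x ∈ᵇ ys
  ∈ᵇ-map-+ x []       = refl
  ∈ᵇ-map-+ x (y ∷ ys) rewrite ≡ᵇ-+ˡ x y | ∈ᵇ-map-+ x ys = refl

  ∈ᵇ-∷-map-+ : ∀ {x} → 0 ℕ.< x → ∀ ys → (a ℕ.+ x) ∈ᵇ (a ∷ map (a ℕ.+_) ys) ≡ x ∈ᵇ ys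
  ∈ᵇ-∷-map-+ {suc x} _ ys rewrite ≡ᵇ-false (ℕ.m+1+n≢m a {x}) = ∈ᵇ-map-+ (suc x) ys

  ∉ᵇ-map-+ : ∀ {ys} → Positive ys → a ∈ᵇ map (a ℕ.+_) ys ≡ false
  ∉ᵇ-map-+ []                 = refl
  ∉ᵇ-map-+ {suc y ∷ _} (_ ∷ ys>0) rewrite ≡ᵇ-false (ℕ.m+1+n≢m a {y} ∘ sym) = ∉ᵇ-map-+ ys>0

  ⊆ᵇ-map-+ : ∀ X Y → map (a ℕ.+_) X ⊆ᵇ map (a ℕ.+_) Y ≡ X ⊆ᵇ Y
  ⊆ᵇ-map-+ []      Y = refl
  ⊆ᵇ-map-+ (x ∷ X) Y = cong₂ _∧_ (∈ᵇ-map-+ x Y) (⊆ᵇ-map-+ X Y)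

  ⊆ᵇ-∷-map-+ : ∀ {X} → Positive X → ∀ Y → map (a ℕ.+_) X ⊆ᵇ (a ∷ map (a ℕ.+_) Y) ≡ X ⊆ᵇ Y
  ⊆ᵇ-∷-map-+ []           Y = refl
  ⊆ᵇ-∷-map-+ (x>0 ∷ X>0) Y = cong₂ _∧_ (∈ᵇ-∷-map-+ x>0 Y) (⊆ᵇ-∷-map-+ X>0 Y)

  ∷-⊆ᵇ-∷-map-+ : ∀ {X} → Positive X → ∀ Y → (a ∷ map (a ℕ.+_) X) ⊆ᵇ (a ∷ map (a ℕ.+_) Y) ≡ X ⊆ᵇ Y
  ∷-⊆ᵇ-∷-map-+ X>0 Y rewrite ≡ᵇ-true {a} refl = ⊆ᵇ-∷-map-+ X>0 Y

  ∷-⊈ᵇ-map-+ : ∀ X {Y} → Positive Y → (a ∷ X) ⊆ᵇ map (a ℕ.+_) Y ≡ false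
  ∷-⊈ᵇ-map-+ X Y>0 rewrite ∉ᵇ-map-+ Y>0 = refl

mo-cut : ∀ a b rest → isOdd a ∧ isEven b ≡ true → mo (a ∷ b ∷ rest) ≡ a ∷ mo (b ∷ rest)
mo-cut a b rest cut rewrite cut = refl

mo-∷-nonempty : ∀ b rest → ∃₂ λ c cs → mo (b ∷ rest) ≡ c ∷ cs
mo-∷-nonempty b []       = b , [] , refl
mo-∷-nonempty b (b′ ∷ r) with isOdd b ∧ isEven b′ | mo (b′ ∷ r)
... | true  | r′     = b , r′ , refl
... | false | []     = b , [] , refl
... | false | c ∷ cs = b ℕ.+ c , cs , refl

partialSums-mo-cut : ∀ a b rest → isOdd a ∧ isEven b ≡ true →
  partialSums (mo (a ∷ b ∷ rest)) ≡ a ∷ map (a ℕ.+_) (partialSums (mo (b ∷ rest)))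
partialSums-mo-cut a b rest cut = trans (cong partialSums (mo-cut a b rest cut)) (partialSums-∷ a (mo (b ∷ rest)))

partialSums-mo-merge : ∀ a b rest → isOdd a ∧ isEven b ≡ false →
  partialSums (mo (a ∷ b ∷ rest)) ≡ map (a ℕ.+_) (partialSums (mo (b ∷ rest)))
partialSums-mo-merge a b rest no-cut with mo-∷-nonempty b rest
... | c , cs , mo≡ rewrite no-cut | mo≡ = cong (a ℕ.+ c ∷_) (partialSumsFrom-+ a c cs)

partialSums-mo-positive : ∀ {b} → 0 ℕ.< b → ∀ rest → Positive (partialSums (mo (b ∷ rest)))
partialSums-mo-positive b>0 []       = b>0 ∷ []
partialSums-mo-positive {b} b>0 (b′ ∷ r) = by-cut (isOdd b ∧ isEven b′) refl
  where
  by-cut : ∀ t → isOdd b ∧ isEven b′ ≡ t → Positive (partialSums (mo (b ∷ b′ ∷ r)))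
  by-cut true  cut    = subst Positive (sym (partialSums-mo-cut b b′ r cut)) (b>0 ∷ map-+-positive b>0 _)
  by-cut false no-cut = subst Positive (sym (partialSums-mo-merge b b′ r no-cut)) (map-+-positive b>0 _)

partialSums-singleton-block : ∀ a bs → partialSums (map sumℕ ((a ∷ []) ∷ bs)) ≡ a ∷ map (a ℕ.+_) (partialSums (map sumℕ bs))
partialSums-singleton-block a bs = trans (cong (λ z → partialSums (z ∷ map sumℕ bs)) (ℕ.+-identityʳ a)) (partialSums-∷ a (map sumℕ bs))

partialSums-extended-block : ∀ a u bs → partialSums (map sumℕ ((a ∷ u) ∷ bs)) ≡ map (a ℕ.+_) (partialSums (map sumℕ (u ∷ bs)))
partialSums-extended-block a u bs = cong (a ℕ.+ sumℕ u ∷_) (partialSumsFrom-+ a (sumℕ u) (map sumℕ bs))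

blockings-head : ∀ b as → All (λ bs → ∃₂ λ c cs → bs ≡ (b ∷ c) ∷ cs) (blockings (b ∷ as))
blockings-head b as = subst (All _) (sym (blockings-∷ b as)) (All.concat⁺ (All.map⁺ (All.universal prepended (blockings as))))
  where
  prepended : ∀ cs → All (λ bs → ∃₂ λ c cs → bs ≡ (b ∷ c) ∷ cs) (prependBlock b cs)
  prepended []       = ([] , [] , refl) ∷ []
  prepended (c ∷ cs) = ([] , c ∷ cs , refl) ∷ (c , cs , refl) ∷ []

inRange : List ℕ → List (List ℕ) → Bool
inRange α bs = (mo α ≤ᶜ map sumℕ bs) ∧ (map sumℕ bs ≤ᶜ α)

-- The two ways prependBlock turns a blocking (b ∷ c) ∷ cs of b ∷ rest into one of a ∷ b ∷ rest.
module _ (a b : ℕ) (rest : List ℕ) (b>0 : 0 ℕ.< b) (c : List ℕ) (cs : List (List ℕ)) where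

  private
    X Y Z : List ℕ
    X = partialSums (mo (b ∷ rest))
    Y = partialSums (map sumℕ ((b ∷ c) ∷ cs))
    Z = partialSums (b ∷ rest)

    X>0 : Positive X
    X>0 = partialSums-mo-positive b>0 rest

    Y>0 : Positive Y
    Y>0 = partialSums-∷-positive (ℕ.<-≤-trans b>0 (ℕ.m≤m+n b (sumℕ c))) (map sumℕ cs)

    partialSums-α : partialSums (a ∷ b ∷ rest) ≡ a ∷ map (a ℕ.+_) Z
    partialSums-α = partialSums-∷ a (b ∷ rest)

  inRange-split-off : inRange (b ∷ rest) ((b ∷ c) ∷ cs) ≡ allᵇ noOtE ((b ∷ c) ∷ cs) →
                      inRange (a ∷ b ∷ rest) ((a ∷ []) ∷ (b ∷ c) ∷ cs) ≡ allᵇ noOtE ((a ∷ []) ∷ (b ∷ c) ∷ cs)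
  inRange-split-off ih = trans (cong₂ _∧_ (lower (isOdd a ∧ isEven b) refl) upper) ih
    where
    upper : partialSums (map sumℕ ((a ∷ []) ∷ (b ∷ c) ∷ cs)) ⊆ᵇ partialSums (a ∷ b ∷ rest) ≡ Y ⊆ᵇ Z
    upper = trans (cong₂ _⊆ᵇ_ (partialSums-singleton-block a ((b ∷ c) ∷ cs)) partialSums-α) (∷-⊆ᵇ-∷-map-+ a Y>0 Z)
    lower : ∀ t → isOdd a ∧ isEven b ≡ t →
            partialSums (mo (a ∷ b ∷ rest)) ⊆ᵇ partialSums (map sumℕ ((a ∷ []) ∷ (b ∷ c) ∷ cs)) ≡ X ⊆ᵇ Y
    lower true  cut    = trans (cong₂ _⊆ᵇ_ (partialSums-mo-cut a b rest cut) (partialSums-singleton-block a ((b ∷ c) ∷ cs)))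
                               (∷-⊆ᵇ-∷-map-+ a X>0 Y)
    lower false no-cut = trans (cong₂ _⊆ᵇ_ (partialSums-mo-merge a b rest no-cut) (partialSums-singleton-block a ((b ∷ c) ∷ cs)))
                               (⊆ᵇ-∷-map-+ a X>0 Y)

  inRange-extend : inRange (b ∷ rest) ((b ∷ c) ∷ cs) ≡ allᵇ noOtE ((b ∷ c) ∷ cs) →
                   inRange (a ∷ b ∷ rest) ((a ∷ b ∷ c) ∷ cs) ≡ allᵇ noOtE ((a ∷ b ∷ c) ∷ cs)
  inRange-extend ih = by-cut (isOdd a ∧ isEven b) refl
    where
    noOtE-α : ∀ {t} → isOdd a ∧ isEven b ≡ t → allᵇ noOtE ((a ∷ b ∷ c) ∷ cs) ≡ (not t ∧ noOtE (b ∷ c)) ∧ allᵇ noOtE cs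
    noOtE-α refl = refl
    by-cut : ∀ t → isOdd a ∧ isEven b ≡ t → inRange (a ∷ b ∷ rest) ((a ∷ b ∷ c) ∷ cs) ≡ allᵇ noOtE ((a ∷ b ∷ c) ∷ cs)
    by-cut true  cut    = trans
      (cong (_∧ (partialSums (map sumℕ ((a ∷ b ∷ c) ∷ cs)) ⊆ᵇ partialSums (a ∷ b ∷ rest)))
            (trans (cong₂ _⊆ᵇ_ (partialSums-mo-cut a b rest cut) (partialSums-extended-block a (b ∷ c) cs))
                   (∷-⊈ᵇ-map-+ a (map (a ℕ.+_) X) Y>0)))
      (sym (noOtE-α cut))
    by-cut false no-cut = trans (cong₂ _∧_
      (trans (cong₂ _⊆ᵇ_ (partialSums-mo-merge a b rest no-cut) (partialSums-extended-block a (b ∷ c) cs)) (⊆ᵇ-map-+ a X Y))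
      (trans (cong₂ _⊆ᵇ_ (partialSums-extended-block a (b ∷ c) cs) partialSums-α) (⊆ᵇ-∷-map-+ a Y>0 Z)))
      (trans ih (sym (noOtE-α no-cut)))

-- β ≤ α holds for every blocking; the cuts of m_o(α) are the OtE positions of α, so m_o(α) ≤ β iff no block
-- straddles one.
blockings-inRange : ∀ α → IsComposition α → All (λ bs → inRange α bs ≡ allᵇ noOtE bs) (blockings α)
blockings-inRange []             _ = refl ∷ []
blockings-inRange (a ∷ [])       _ = singleton ∷ []
  where
  singleton : inRange (a ∷ []) ((a ∷ []) ∷ []) ≡ true
  singleton rewrite ℕ.+-identityʳ a | ≡ᵇ-true {a} refl = refl
blockings-inRange (a ∷ b ∷ rest) (_ ∷ b>0 ∷ rest>0) = subst (All _) (sym (blockings-∷ a (b ∷ rest)))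
  (All.concat⁺ (All.map⁺ (All.map (λ { (ih , (c , cs , refl)) →
                                         inRange-split-off a b rest b>0 c cs ih ∷ inRange-extend a b rest b>0 c cs ih ∷ [] })
                                  (All.zip (blockings-inRange (b ∷ rest) (b>0 ∷ rest>0) , blockings-head b rest)))))

coeff-blockingWeight : ∀ bs → when (allᵇ noOtE bs) (coeff bs) ≡ blockingWeight bs
coeff-blockingWeight []       = refl
coeff-blockingWeight (b ∷ bs) =
  trans (sym (when-*-when (noOtE b) (allᵇ noOtE bs) (blockCoeff b) (coeff bs))) (cong (blockWeight b *_) (coeff-blockingWeight bs))

S≡Sᵇ : ∀ α → IsComposition α → ∀ e → S α e ≡ Sᵇ α e
S≡Sᵇ α cα e = begin
  S α e
    ≡⟨ Σ-map (blockings α) _ (λ f → f e) ⟩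
  Σ[ blockings α ] (λ bs → (if inRange α bs then (λ e → coeff bs * M (map sumℕ bs) e) else (λ _ → 0ℚ)) e)
    ≡⟨ Σ-cong (blockings α) (λ bs → if-float (λ f → f e) (inRange α bs) {λ e → coeff bs * M (map sumℕ bs) e} {λ _ → 0ℚ}) ⟩
  Σ[ blockings α ] (λ bs → when (inRange α bs) (coeff bs * M (map sumℕ bs) e))
    ≡⟨ Σ-cong-All (All.map (λ {bs} inRange≡ → begin
         when (inRange α bs) (coeff bs * M (map sumℕ bs) e)  ≡⟨ if-cong inRange≡ ⟩
         when (allᵇ noOtE bs) (coeff bs * M (map sumℕ bs) e) ≡⟨ sym (when-*ˡ (allᵇ noOtE bs) (coeff bs) _) ⟩
         when (allᵇ noOtE bs) (coeff bs) * M (map sumℕ bs) e ≡⟨ cong (_* M (map sumℕ bs) e) (coeff-blockingWeight bs) ⟩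
         blockingWeight bs * M (map sumℕ bs) e              ∎)
       (blockings-inRange α cα)) ⟩
  Sᵇ α e ∎
  where open ≡-Reasoning

S≡Ŝ : ∀ α → IsComposition α → ∀ e → S α e ≡ Ŝ α e
S≡Ŝ α cα e = trans (S≡Sᵇ α cα e) (Sᵇ≡Ŝ e α cα)

mainTheorem2 : (α β : List ℕ) → IsComposition α → IsComposition β →
    (e : List ℕ) → (S α ·ₛ S β) e ≡ ΣS (map S (shuffle α β)) e
mainTheorem2 α β cα cβ e = begin
  (S α ·ₛ S β) e
    ≡⟨ Σ-cong (splits e) (λ (d , d′) → cong₂ _*_ (S≡Ŝ α cα d) (S≡Ŝ β cβ d′)) ⟩
  (Ŝ α ·ₛ Ŝ β) e
    ≡⟨ Ŝ-product e α β ⟩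
  Σ[ shuffle α β ] (λ γ → Ŝ γ e)
    ≡⟨ Σ-cong-All (All.map (λ {γ} cγ → sym (S≡Ŝ γ cγ e)) (shuffle-composition cα cβ)) ⟩
  Σ[ shuffle α β ] (λ γ → S γ e)
    ≡⟨ sym (Σ-map (shuffle α β) S (λ f → f e)) ⟩
  ΣS (map S (shuffle α β)) e ∎
  where open ≡-Reasoning
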